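{- $\displaystyle\liminf_{k\to\infty}\frac{\Gamma(k)}{k}=\frac{3}{2}$.
   Context: The Thue-Morse word is the infinite binary word ${\bf t}={\bf t}_1{\bf t}_2{\bf t}_3\cdots$, where ${\bf t}_i\in\{0,1\}$ has the same parity as the number of $1$'s in the binary expansion of $i-1$. A $k$-anti-power is a word of the form $w_1w_2\cdots w_k$ where $w_1,\ldots,w_k$ are pairwise distinct words all of the same length. Let $\mathcal F(k)$ denote the set of odd positive integers $m$ such that the prefix of ${\bf t}$ of length $km$ is a $k$-anti-power. Define $\Gamma(k)=\sup\big((2\mathbb Z^+-1)\setminus\mathcal F(k)\big)$, the supremum of the set of odd positive integers not in $\mathcal F(k)$. -}

module Defs where

open import Data.Nat using (ℕ; zero; suc; _+_; _*_; _<_; _%_; _/_)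
open import Data.Bool using (Bool; true; false; not)
open import Data.Fin using (Fin; toℕ)
open import Data.Vec using (Vec; tabulate)
open import Data.Product using (∃-syntax)
open import Relation.Binary.PropositionalEquality using (_≡_; _≢_)

-- Parity of the number of 1's in the binary expansion of n, computed with
-- fuel f (fuel f ≥ number of binary digits suffices; we use fuel n).
bitParity : ℕ → ℕ → Bool
bitParity zero      n = false
bitParity (suc f)   n with n % 2
... | 0 = bitParity f (n / 2)
... | _ = not (bitParity f (n / 2))

-- Thue–Morse word, 0-indexed: tm i = t_{i+1}, which has the parity of the
-- number of 1's in the binary expansion of i  (false = 0, true = 1).
tm : ℕ → Bool
tm i = bitParity i i

-- The j-th block (0-indexed) of length m of the prefix of t:
-- t_{jm+1} ... t_{jm+m}.
block : (m : ℕ) → ℕ → Vec Bool m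
block m j = tabulate {n = m} (λ (i : Fin m) → tm (j * m + toℕ i))

AntiPowerPrefix : ℕ → ℕ → Set
AntiPowerPrefix k m = ∀ i j → i < k → j < k → i ≢ j → block m i ≢ block m j

Odd : ℕ → Set
Odd m = ∃[ r ] m ≡ 2 * r + 1

-- For k = 2^(a+1), every odd m > 3·2^a makes the prefix of length km a k-anti-power:
-- if blocks i < j < k coincide, write j − i = 2^s·c with c odd and s ≤ a.  The positions
-- i·m + t·2^s (t < 4) lie in block i, and splitting off their low s bits, t(2^s·y + z) = t(y) ⊕ t(z),
-- turns the equality of the two blocks there into a factor of length 4 of t that recurs at the odd
-- distance c·m, which t does not have.  Hence Γ(k) ≤ 3k/2 for infinitely many k.
--
-- Let P = 2^g − 1 with g even, A = 2^N ≥ 8·2^g, S = A·2^g and m = A(3P+2) − 1 (odd).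
-- The positions of block 2P+1 have high parts (quotients by S) in {6P+1, 6P+2, 6P+3}, and on these
-- t(q + m) = t(q); so blocks 2P+1 and 2P+1+S coincide.  Choosing S with S ≤ k − 2^(g+1) < 2S gives an
-- odd m ∉ 𝓕(k) with m/k close to 3/2 once 2^g is large.
module Submission where

open import Defs
open import Data.Nat using (ℕ; _+_; _*_; _<_; _≤_)
open import Data.Product using (_×_; ∃-syntax)
open import Relation.Nullary using (¬_)

open import Data.Nat using (zero; suc; _%_; _/_; _^_; _∸_; _<?_; >-nonZero; z≤n; s≤s; z<s; s<s; NonZero)
open import Data.Nat.Properties
open import Data.Nat.DivMod
open import Data.Nat.Divisibility using (divides-refl)
open import Data.Nat.Induction using (<-rec)
open import Data.Nat.Tactic.RingSolver using (solve-∀; solve)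
open import Data.Bool using (true; false; not; _xor_)
open import Data.Bool.Properties using (not-involutive; not-distribʳ-xor; xor-identityʳ; xor-same; xor-assoc; not-¬)
open import Data.Empty using (⊥)
open import Data.Fin using (toℕ; fromℕ<)
open import Data.Fin.Properties using (toℕ-fromℕ<; toℕ<n)
open import Data.List using ([]; _∷_)
open import Data.Product using (_,_)
open import Data.Sum using (_⊎_; inj₁; inj₂)
open import Data.Vec using (lookup)
open import Data.Vec.Properties using (lookup∘tabulate; tabulate-cong)
open import Function using (_∘_)
open import Relation.Binary.Definitions using (tri<; tri≈; tri>)
open import Relation.Binary.PropositionalEquality
open import Relation.Nullary using (yes; no; contradiction)

even-or-odd : ∀ n → ∃[ y ] (n ≡ 2 * y ⊎ n ≡ 2 * y + 1)
even-or-odd zero = 0 , inj₁ refl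
even-or-odd (suc n) with even-or-odd n
... | y , inj₁ refl = y , inj₂ (+-comm 1 (2 * y))
... | y , inj₂ refl = suc y , inj₁ (solve (y ∷ []))

n<2^n : ∀ n → n < 2 ^ n
n<2^n zero    = z<s
n<2^n (suc n) = subst (suc n <_) (cong (2 ^ n +_) (sym (+-identityʳ (2 ^ n)))) (+-mono-≤-< (m^n>0 2 n) (n<2^n n))

2^-cancel-< : ∀ {m n} → 2 ^ m < 2 ^ n → m < n
2^-cancel-< {m} {n} 2^m<2^n with m <? n
... | yes m<n = m<n
... | no  m≮n = contradiction (^-monoʳ-≤ 2 (≮⇒≥ m≮n)) (<⇒≱ 2^m<2^n)

2^-bracket : ∀ x → ∃[ b ] (2 ^ b ≤ suc x × suc x < 2 ^ suc b)
2^-bracket zero = 0 , ≤-refl , s<s (s<s z≤n)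
2^-bracket (suc x) with 2^-bracket x
... | b , lo , hi with suc (suc x) <? 2 ^ suc b
...   | yes below = b , m≤n⇒m≤1+n lo , below
...   | no  above = suc b , ≮⇒≥ above , ≤-<-trans hi (^-monoʳ-< 2 (s<s (s<s z≤n)) (n<1+n (suc b)))

dyadic-scale : ∀ c g x → 2 ^ (c + g) ≤ x → ∃[ N ] (c ≤ N × 2 ^ (N + g) ≤ x × x < 2 * 2 ^ (N + g))
dyadic-scale c g zero 2^[c+g]≤0 = contradiction 2^[c+g]≤0 (<⇒≱ (m^n>0 2 (c + g)))
dyadic-scale c g (suc x) 2^[c+g]≤x with 2^-bracket x
... | b , 2^b≤x , x<2^b+1 = b ∸ g , c≤N , subst (_≤ suc x) 2^b≡ 2^b≤x , subst (λ S → suc x < 2 * S) 2^b≡ x<2^b+1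
  where
  c+g≤b : c + g ≤ b
  c+g≤b = ≤-pred (2^-cancel-< (≤-<-trans 2^[c+g]≤x x<2^b+1))
  N+g≡b : b ∸ g + g ≡ b
  N+g≡b = m∸n+n≡m (≤-trans (m≤n+m g c) c+g≤b)
  c≤N : c ≤ b ∸ g
  c≤N = +-cancelʳ-≤ g c (b ∸ g) (subst (c + g ≤_) (sym N+g≡b) c+g≤b)
  2^b≡ : 2 ^ b ≡ 2 ^ (b ∸ g + g)
  2^b≡ = cong (2 ^_) (sym N+g≡b)

divMod-2^ : ∀ r p → ∃[ q ] ∃[ ρ ] (ρ < 2 ^ r × p ≡ 2 ^ r * q + ρ)
divMod-2^ r p = p / 2 ^ r , p % 2 ^ r , m%n<n p (2 ^ r) ,
  trans (m≡m%n+[m/n]*n p (2 ^ r)) (trans (+-comm (p % 2 ^ r) _) (cong (_+ p % 2 ^ r) (*-comm (p / 2 ^ r) (2 ^ r))))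
  where
  instance
    2^r≢0 : NonZero (2 ^ r)
    2^r≢0 = m^n≢0 2 r

2-adic-decomposition : ∀ D → 0 < D → ∃[ s ] ∃[ c ] (Odd c × D ≡ 2 ^ s * c)
2-adic-decomposition = <-rec _ by-parity
  where
  by-parity : ∀ D → (∀ {D'} → D' < D → 0 < D' → ∃[ s ] ∃[ c ] (Odd c × D' ≡ 2 ^ s * c)) →
              0 < D → ∃[ s ] ∃[ c ] (Odd c × D ≡ 2 ^ s * c)
  by-parity D rec D>0 with even-or-odd D
  ... | y , inj₂ refl = 0 , 2 * y + 1 , (y , refl) , sym (+-identityʳ _)
  ... | zero , inj₁ refl = contradiction D>0 (<-irrefl refl)
  ... | suc y , inj₁ refl with rec (m<m+n (suc y) z<s) z<s
  ...   | s , c , odd-c , y≡ = suc s , c , odd-c , trans (cong (2 *_) y≡) (sym (*-assoc 2 (2 ^ s) c))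

Odd-* : ∀ {a b} → Odd a → Odd b → Odd (a * b)
Odd-* (r , refl) (r' , refl) = 2 * r * r' + r + r' , solve (r ∷ r' ∷ [])

Odd⇒NonZero : ∀ {c} → Odd c → NonZero c
Odd⇒NonZero (r , refl) = >-nonZero (subst (0 <_) (+-comm 1 (2 * r)) z<s)

odd-predecessor : ∀ N c → 0 < N → 0 < c → ∃[ m ] (Odd m × m + 1 ≡ 2 ^ N * c)
odd-predecessor (suc N) c _ c>0 with 2 ^ N * c in eq | *-mono-≤ (m^n>0 2 N) c>0
... | suc r | _ = 2 * r + 1 , (r , refl) , (begin
  2 * r + 1 + 1    ≡⟨ solve (r ∷ []) ⟩
  2 * suc r        ≡⟨ cong (2 *_) eq ⟨
  2 * (2 ^ N * c)  ≡⟨ *-assoc 2 (2 ^ N) c ⟨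
  2 ^ suc N * c    ∎)
  where open ≡-Reasoning

xor-cancelʳ : ∀ c {a b} → a xor c ≡ b xor c → a ≡ b
xor-cancelʳ c {a} {b} e = begin
  a                ≡⟨ xor-identityʳ a ⟨
  a xor false      ≡⟨ cong (a xor_) (xor-same c) ⟨
  a xor (c xor c)  ≡⟨ xor-assoc a c c ⟨
  (a xor c) xor c  ≡⟨ cong (_xor c) e ⟩
  (b xor c) xor c  ≡⟨ xor-assoc b c c ⟩
  b xor (c xor c)  ≡⟨ cong (b xor_) (xor-same c) ⟩
  b xor false      ≡⟨ xor-identityʳ b ⟩
  b                ∎
  where open ≡-Reasoning

-- The Thue–Morse word

bitParity-zero : ∀ f → bitParity f 0 ≡ false
bitParity-zero zero    = refl
bitParity-zero (suc f) = bitParity-zero f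

bitParity-suc-even : ∀ f n → n % 2 ≡ 0 → bitParity (suc f) n ≡ bitParity f (n / 2)
bitParity-suc-even f n n%2≡0 rewrite n%2≡0 = refl

bitParity-suc-odd : ∀ f n → n % 2 ≡ 1 → bitParity (suc f) n ≡ not (bitParity f (n / 2))
bitParity-suc-odd f n n%2≡1 rewrite n%2≡1 = refl

m≤1+n⇒m/2≤n : ∀ {m n} → m ≤ suc n → m / 2 ≤ n
m≤1+n⇒m/2≤n {zero}  _     = z≤n
m≤1+n⇒m/2≤n {suc m} m≤1+n = ≤-pred (≤-trans (m/n<m (suc m) 2 ≤-refl) m≤1+n)

bitParity-fuel-irrelevant : ∀ f g n → n ≤ f → n ≤ g → bitParity f n ≡ bitParity g n
bitParity-fuel-irrelevant zero    g       _ z≤n _   = sym (bitParity-zero g)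
bitParity-fuel-irrelevant (suc f) zero    _ _   z≤n = bitParity-zero (suc f)
bitParity-fuel-irrelevant (suc f) (suc g) n n≤f n≤g with n % 2
... | zero  = bitParity-fuel-irrelevant f g (n / 2) (m≤1+n⇒m/2≤n n≤f) (m≤1+n⇒m/2≤n n≤g)
... | suc _ = cong not (bitParity-fuel-irrelevant f g (n / 2) (m≤1+n⇒m/2≤n n≤f) (m≤1+n⇒m/2≤n n≤g))

bitParity≡tm : ∀ f n → n ≤ f → bitParity f n ≡ tm n
bitParity≡tm f n n≤f = bitParity-fuel-irrelevant f n n n≤f ≤-refl

tm-double : ∀ x → tm (2 * x) ≡ tm x
tm-double x = begin
  tm (2 * x)                       ≡⟨ bitParity≡tm (suc (2 * x)) (2 * x) (n≤1+n _) ⟨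
  bitParity (suc (2 * x)) (2 * x)  ≡⟨ bitParity-suc-even (2 * x) (2 * x) (trans (cong (_% 2) (*-comm 2 x)) (m*n%n≡0 x 2)) ⟩
  bitParity (2 * x) (2 * x / 2)    ≡⟨ cong (bitParity (2 * x)) (trans (cong (_/ 2) (*-comm 2 x)) (m*n/n≡m x 2)) ⟩
  bitParity (2 * x) x              ≡⟨ bitParity≡tm (2 * x) x (m≤n*m x 2) ⟩
  tm x                             ∎
  where open ≡-Reasoning

tm-double+1 : ∀ x → tm (2 * x + 1) ≡ not (tm x)
tm-double+1 x = begin
  tm (2 * x + 1)                           ≡⟨ bitParity≡tm (suc (2 * x + 1)) (2 * x + 1) (n≤1+n _) ⟨
  bitParity (suc (2 * x + 1)) (2 * x + 1)  ≡⟨ bitParity-suc-odd (2 * x + 1) (2 * x + 1) (trans (cong (_% 2) 2x+1≡1+x*2) ([m+kn]%n≡m%n 1 x 2)) ⟩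
  not (bitParity (2 * x + 1) ((2 * x + 1) / 2)) ≡⟨ cong (not ∘ bitParity (2 * x + 1)) (trans (cong (_/ 2) 2x+1≡1+x*2) (trans (+-distrib-/-∣ʳ 1 {x * 2} (divides-refl x)) (m*n/n≡m x 2))) ⟩
  not (bitParity (2 * x + 1) x)            ≡⟨ cong not (bitParity≡tm (2 * x + 1) x (≤-trans (m≤n*m x 2) (m≤m+n _ 1))) ⟩
  not (tm x)                               ∎
  where
  open ≡-Reasoning
  2x+1≡1+x*2 : 2 * x + 1 ≡ 1 + x * 2
  2x+1≡1+x*2 = solve (x ∷ [])

tm-bit : ∀ x b → b < 2 → tm (2 * x + b) ≡ tm x xor tm b
tm-bit x 0 _ = trans (cong tm (+-identityʳ (2 * x))) (trans (tm-double x) (sym (xor-identityʳ (tm x))))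
tm-bit x 1 _ = trans (tm-double+1 x) (trans (cong not (sym (xor-identityʳ (tm x)))) (not-distribʳ-xor (tm x) false))
tm-bit x (suc (suc _)) (s<s (s<s ()))

tm-split : ∀ r y z → z < 2 ^ r → tm (2 ^ r * y + z) ≡ tm y xor tm z
tm-split zero    y zero    _        = trans (cong tm (trans (+-identityʳ _) (*-identityˡ y))) (sym (xor-identityʳ (tm y)))
tm-split zero    y (suc _) (s<s ())
tm-split (suc r) y z z<2^r+1 with divMod-2^ 1 z
... | z' , b , b<2 , refl = begin
  tm (2 ^ suc r * y + (2 * z' + b))    ≡⟨ cong tm (regroup (2 ^ r) y z' b) ⟩
  tm (2 * (2 ^ r * y + z') + b)        ≡⟨ tm-bit (2 ^ r * y + z') b b<2 ⟩
  tm (2 ^ r * y + z') xor tm b         ≡⟨ cong (_xor tm b) (tm-split r y z' z'<2^r) ⟩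
  (tm y xor tm z') xor tm b            ≡⟨ xor-assoc (tm y) (tm z') (tm b) ⟩
  tm y xor (tm z' xor tm b)            ≡⟨ cong (tm y xor_) (tm-bit z' b b<2) ⟨
  tm y xor tm (2 * z' + b)             ∎
  where
  open ≡-Reasoning
  regroup : ∀ S y z b → 2 * S * y + (2 * z + b) ≡ 2 * (S * y + z) + b
  regroup = solve-∀
  z'<2^r : z' < 2 ^ r
  z'<2^r = *-cancelˡ-< 2 _ _ (≤-<-trans (m≤m+n (2 * z') b) z<2^r+1)

tm-pair : ∀ w → tm (2 * w + 1) ≡ not (tm (2 * w))
tm-pair w = trans (tm-double+1 w) (cong not (sym (tm-double w)))

tm-no-three-equal : ∀ z → tm z ≡ tm (z + 1) → tm (z + 1) ≡ tm (z + 2) → ⊥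
tm-no-three-equal z z≡z+1 z+1≡z+2 with even-or-odd z
... | w , inj₁ refl = not-¬ refl (trans z≡z+1 (tm-pair w))
... | w , inj₂ refl = not-¬ refl (begin
  tm (2 * (w + 1))       ≡⟨ cong tm e₁ ⟨
  tm (2 * w + 1 + 1)     ≡⟨ z+1≡z+2 ⟩
  tm (2 * w + 1 + 2)     ≡⟨ cong tm e₂ ⟩
  tm (2 * (w + 1) + 1)   ≡⟨ tm-pair (w + 1) ⟩
  not (tm (2 * (w + 1))) ∎)
  where
  open ≡-Reasoning
  e₁ : 2 * w + 1 + 1 ≡ 2 * (w + 1)
  e₁ = solve (w ∷ [])
  e₂ : 2 * w + 1 + 2 ≡ 2 * (w + 1) + 1
  e₂ = solve (w ∷ [])

-- Halving the four equalities gives t(z) = t(z+1) = t(z+2).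
tm-no-odd-shift-aligned : ∀ y z → ¬ (∀ t → t < 4 → tm (2 * y + t) ≡ tm (2 * z + 1 + t))
tm-no-odd-shift-aligned y z agree = tm-no-three-equal z
  (trans (sym (not-involutive (tm z))) (trans (cong not (sym e₀)) e₁))
  (trans (sym (not-involutive (tm (z + 1)))) (trans (cong not (sym e₂)) e₃))
  where
  open ≡-Reasoning
  agree-at : ∀ t a b → t < 4 → 2 * y + t ≡ a → 2 * z + 1 + t ≡ b → tm a ≡ tm b
  agree-at t _ _ t<4 refl refl = agree t t<4
  e₀ : tm y ≡ not (tm z)
  e₀ = begin
    tm y             ≡⟨ tm-double y ⟨
    tm (2 * y)       ≡⟨ agree-at 0 (2 * y) (2 * z + 1) z<s (+-identityʳ (2 * y)) (+-identityʳ (2 * z + 1)) ⟩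
    tm (2 * z + 1)   ≡⟨ tm-double+1 z ⟩
    not (tm z)       ∎
  e₁ : not (tm y) ≡ tm (z + 1)
  e₁ = begin
    not (tm y)       ≡⟨ tm-double+1 y ⟨
    tm (2 * y + 1)   ≡⟨ agree-at 1 (2 * y + 1) (2 * (z + 1)) (s<s z<s) refl (solve (z ∷ [])) ⟩
    tm (2 * (z + 1)) ≡⟨ tm-double (z + 1) ⟩
    tm (z + 1)       ∎
  e₂ : tm (y + 1) ≡ not (tm (z + 1))
  e₂ = begin
    tm (y + 1)           ≡⟨ tm-double (y + 1) ⟨
    tm (2 * (y + 1))     ≡⟨ agree-at 2 (2 * (y + 1)) (2 * (z + 1) + 1) (s<s (s<s z<s)) (solve (y ∷ [])) (solve (z ∷ [])) ⟩
    tm (2 * (z + 1) + 1) ≡⟨ tm-double+1 (z + 1) ⟩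
    not (tm (z + 1))     ∎
  e₃ : not (tm (y + 1)) ≡ tm (z + 2)
  e₃ = begin
    not (tm (y + 1))     ≡⟨ tm-double+1 (y + 1) ⟨
    tm (2 * (y + 1) + 1) ≡⟨ agree-at 3 (2 * (y + 1) + 1) (2 * (z + 2)) (s<s (s<s (s<s z<s))) (solve (y ∷ [])) (solve (z ∷ [])) ⟩
    tm (2 * (z + 2))     ≡⟨ tm-double (z + 2) ⟩
    tm (z + 2)           ∎

tm-no-odd-shift : ∀ p d → Odd d → ¬ (∀ t → t < 4 → tm (p + t) ≡ tm (p + d + t))
tm-no-odd-shift p d (r , refl) agree = by-parity (even-or-odd p)
  where
  agree-at : ∀ a b → p ≡ a → p + (2 * r + 1) ≡ b → ∀ t → t < 4 → tm (a + t) ≡ tm (b + t)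
  agree-at _ _ refl refl = agree
  by-parity : ∃[ y ] (p ≡ 2 * y ⊎ p ≡ 2 * y + 1) → ⊥
  by-parity (y , inj₁ p≡2y) = tm-no-odd-shift-aligned y (y + r)
    (agree-at (2 * y) (2 * (y + r) + 1) p≡2y (trans (cong (_+ (2 * r + 1)) p≡2y) (solve (y ∷ r ∷ []))))
  by-parity (y , inj₂ p≡2y+1) = tm-no-odd-shift-aligned (y + r + 1) y λ t t<4 → sym
    (agree-at (2 * y + 1) (2 * (y + r + 1)) p≡2y+1 (trans (cong (_+ (2 * r + 1)) p≡2y+1) (solve (y ∷ r ∷ []))) t t<4)

tm-alternates : ∀ x t → t < 3 → tm (8 * x + (3 + t)) ≡ not (tm (8 * x + (2 + t)))
tm-alternates x t t<3 = begin
  tm (8 * x + (3 + t))        ≡⟨ tm-split 3 x (3 + t) (<-≤-trans (+-monoʳ-< 3 t<3) (m≤m+n 6 2)) ⟩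
  tm x xor tm (3 + t)         ≡⟨ cong (tm x xor_) (letters t t<3) ⟩
  tm x xor not (tm (2 + t))   ≡⟨ not-distribʳ-xor (tm x) (tm (2 + t)) ⟨
  not (tm x xor tm (2 + t))   ≡⟨ cong not (tm-split 3 x (2 + t) (<-≤-trans (+-monoʳ-< 2 t<3) (m≤m+n 5 3))) ⟨
  not (tm (8 * x + (2 + t)))  ∎
  where
  open ≡-Reasoning
  letters : ∀ t → t < 3 → tm (3 + t) ≡ not (tm (2 + t))
  letters 0 _ = refl
  letters 1 _ = refl
  letters 2 _ = refl
  letters (suc (suc (suc _))) (s<s (s<s (s<s ())))

mersenne : ℕ → ℕ
mersenne zero    = 0
mersenne (suc r) = 2 * mersenne r + 1

mersenne+1 : ∀ r → mersenne r + 1 ≡ 2 ^ r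
mersenne+1 zero    = refl
mersenne+1 (suc r) = trans (+-assoc (2 * mersenne r) 1 1)
  (trans (sym (*-distribˡ-+ 2 (mersenne r) 1)) (cong (2 *_) (mersenne+1 r)))

tm-mersenne-even : ∀ q → tm (mersenne (2 * q)) ≡ false
tm-mersenne-even zero    = refl
tm-mersenne-even (suc q) = begin
  tm (mersenne (2 * suc q))              ≡⟨ cong (tm ∘ mersenne) (*-suc 2 q) ⟩
  tm (2 * (2 * mersenne (2 * q) + 1) + 1) ≡⟨ tm-double+1 (2 * mersenne (2 * q) + 1) ⟩
  not (tm (2 * mersenne (2 * q) + 1))     ≡⟨ cong not (tm-double+1 (mersenne (2 * q))) ⟩
  not (not (tm (mersenne (2 * q))))       ≡⟨ not-involutive (tm (mersenne (2 * q))) ⟩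
  tm (mersenne (2 * q))                   ≡⟨ tm-mersenne-even q ⟩
  false                                   ∎
  where open ≡-Reasoning

block-lookup : ∀ m i j → block m i ≡ block m j → ∀ x → x < m → tm (i * m + x) ≡ tm (j * m + x)
block-lookup m i j eq x x<m = subst (λ v → tm (i * m + v) ≡ tm (j * m + v)) (toℕ-fromℕ< x<m) (begin
  tm (i * m + toℕ ι)          ≡⟨ lookup∘tabulate _ ι ⟨
  lookup (block m i) ι        ≡⟨ cong (λ w → lookup w ι) eq ⟩
  lookup (block m j) ι        ≡⟨ lookup∘tabulate _ ι ⟩
  tm (j * m + toℕ ι)          ∎)
  where
  open ≡-Reasoning
  ι = fromℕ< x<m

block-≡ : ∀ m i j → (∀ x → x < m → tm (i * m + x) ≡ tm (j * m + x)) → block m i ≡ block m j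
block-≡ _ _ _ agree = tabulate-cong λ ι → agree (toℕ ι) (toℕ<n ι)

equal-blocks⇒¬AntiPowerPrefix : ∀ {k m i j} → i < j → j < k → block m i ≡ block m j → ¬ AntiPowerPrefix k m
equal-blocks⇒¬AntiPowerPrefix {i = i} {j} i<j j<k eq anti = anti i j (<-trans i<j j<k) j<k (<⇒≢ i<j) eq

block-shift : ∀ r m i → (∀ x q ρ → x < m → ρ < 2 ^ r → i * m + x ≡ 2 ^ r * q + ρ → tm (q + m) ≡ tm q) →
              block m i ≡ block m (i + 2 ^ r)
block-shift r m i high-periodic = block-≡ m i (i + 2 ^ r) agree
  where
  open ≡-Reasoning
  shifted : ∀ S q ρ x → i * m + x ≡ S * q + ρ → (i + S) * m + x ≡ S * (q + m) + ρ
  shifted S q ρ x e = begin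
    (i + S) * m + x      ≡⟨ solve (i ∷ S ∷ m ∷ x ∷ []) ⟩
    i * m + x + S * m    ≡⟨ cong (_+ S * m) e ⟩
    S * q + ρ + S * m    ≡⟨ solve (S ∷ q ∷ ρ ∷ m ∷ []) ⟩
    S * (q + m) + ρ      ∎
  agree : ∀ x → x < m → tm (i * m + x) ≡ tm ((i + 2 ^ r) * m + x)
  agree x x<m with divMod-2^ r (i * m + x)
  ... | q , ρ , ρ<2^r , e = begin
    tm (i * m + x)                ≡⟨ cong tm e ⟩
    tm (2 ^ r * q + ρ)            ≡⟨ tm-split r q ρ ρ<2^r ⟩
    tm q xor tm ρ                 ≡⟨ cong (_xor tm ρ) (high-periodic x q ρ x<m ρ<2^r e) ⟨
    tm (q + m) xor tm ρ           ≡⟨ tm-split r (q + m) ρ ρ<2^r ⟨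
    tm (2 ^ r * (q + m) + ρ)      ≡⟨ cong tm (shifted (2 ^ r) q ρ x e) ⟨
    tm ((i + 2 ^ r) * m + x)      ∎

-- Anti-powers for k = 2^(a+1)

-- At scale 2^s the positions i·m + t·2^s (t < 4) read t(h + t), and in the other block t(h + c·m + t).
block-≢-odd-offset : ∀ s c m i → Odd c → Odd m → 3 * 2 ^ s < m → block m i ≢ block m (i + 2 ^ s * c)
block-≢-odd-offset s c m i odd-c odd-m 3·2^s<m eq with divMod-2^ s (i * m)
... | h , ρ , ρ<2^s , im≡ = tm-no-odd-shift h (c * m) (Odd-* odd-c odd-m) λ t t<4 →
  xor-cancelʳ (tm ρ) (begin
    tm (h + t) xor tm ρ                    ≡⟨ tm-split s (h + t) ρ ρ<2^s ⟨
    tm (2 ^ s * (h + t) + ρ)               ≡⟨ cong tm (at-i (2 ^ s) t im≡) ⟨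
    tm (i * m + t * 2 ^ s)                 ≡⟨ block-lookup m i (i + 2 ^ s * c) eq (t * 2 ^ s) (offset<m t<4) ⟩
    tm ((i + 2 ^ s * c) * m + t * 2 ^ s)   ≡⟨ cong tm (at-j (2 ^ s) t im≡) ⟩
    tm (2 ^ s * (h + c * m + t) + ρ)       ≡⟨ tm-split s (h + c * m + t) ρ ρ<2^s ⟩
    tm (h + c * m + t) xor tm ρ            ∎)
  where
  open ≡-Reasoning
  offset<m : ∀ {t} → t < 4 → t * 2 ^ s < m
  offset<m t<4 = ≤-<-trans (*-monoˡ-≤ (2 ^ s) (≤-pred t<4)) 3·2^s<m
  at-i : ∀ S t → i * m ≡ S * h + ρ → i * m + t * S ≡ S * (h + t) + ρ
  at-i S t e = begin
    i * m + t * S          ≡⟨ cong (_+ t * S) e ⟩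
    S * h + ρ + t * S      ≡⟨ solve (S ∷ h ∷ ρ ∷ t ∷ []) ⟩
    S * (h + t) + ρ        ∎
  at-j : ∀ S t → i * m ≡ S * h + ρ → (i + S * c) * m + t * S ≡ S * (h + c * m + t) + ρ
  at-j S t e = begin
    (i + S * c) * m + t * S      ≡⟨ solve (i ∷ S ∷ c ∷ m ∷ t ∷ []) ⟩
    i * m + (c * m + t) * S      ≡⟨ cong (_+ (c * m + t) * S) e ⟩
    S * h + ρ + (c * m + t) * S  ≡⟨ solve (S ∷ h ∷ ρ ∷ c ∷ m ∷ t ∷ []) ⟩
    S * (h + c * m + t) + ρ      ∎

block-≢-below-2^ : ∀ a m {i j} → Odd m → 3 * 2 ^ a < m → i < j → j < 2 ^ suc a → block m i ≢ block m j
block-≢-below-2^ a m {i} {j} odd-m 3·2^a<m i<j j<2^a+1 with 2-adic-decomposition (j ∸ i) (m<n⇒0<n∸m i<j)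
... | s , c , odd-c , j∸i≡ = subst (λ j → block m i ≢ block m j) j≡ (block-≢-odd-offset s c m i odd-c odd-m 3·2^s<m)
  where
  j≡ : i + 2 ^ s * c ≡ j
  j≡ = trans (cong (i +_) (sym j∸i≡)) (m+[n∸m]≡n (<⇒≤ i<j))
  s<a+1 : s < suc a
  s<a+1 = 2^-cancel-< (≤-<-trans (m≤m*n (2 ^ s) c {{Odd⇒NonZero odd-c}})
    (subst (_< 2 ^ suc a) j∸i≡ (≤-<-trans (m∸n≤m j i) j<2^a+1)))
  3·2^s<m : 3 * 2 ^ s < m
  3·2^s<m = ≤-<-trans (*-monoʳ-≤ 3 (^-monoʳ-≤ 2 (≤-pred s<a+1))) 3·2^a<m

antiPowerPrefix-2^ : ∀ a m → Odd m → 3 * 2 ^ a < m → AntiPowerPrefix (2 ^ suc a) m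
antiPowerPrefix-2^ a m odd-m 3·2^a<m i j i<k j<k i≢j with <-cmp i j
... | tri< i<j _ _ = block-≢-below-2^ a m odd-m 3·2^a<m i<j j<k
... | tri≈ _ i≡j _ = contradiction i≡j i≢j
... | tri> _ _ j<i = block-≢-below-2^ a m odd-m 3·2^a<m j<i i<k ∘ sym

upper-bound : ∀ n K → ∃[ k ] (K ≤ k × (∀ m → Odd m → ¬ AntiPowerPrefix k m →
                2 * (n + 1) * m < (3 * n + 5) * k))
upper-bound n K = 2 ^ suc K , <⇒≤ (<-trans (n<1+n K) (n<2^n (suc K))) , bound
  where
  bound : ∀ m → Odd m → ¬ AntiPowerPrefix (2 ^ suc K) m → 2 * (n + 1) * m < (3 * n + 5) * 2 ^ suc K
  bound m odd-m not-anti = ≤-<-trans (*-monoʳ-≤ (2 * (n + 1)) m≤3·2^K)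
    (subst (_< (3 * n + 5) * 2 ^ suc K) (sym (regroup n (2 ^ K)))
      (*-monoˡ-< (2 ^ suc K) {{m^n≢0 2 (suc K)}} (+-monoʳ-< (3 * n) (m≤n⇒m≤1+n (n<1+n 3)))))
    where
    m≤3·2^K : m ≤ 3 * 2 ^ K
    m≤3·2^K = ≮⇒≥ (not-anti ∘ antiPowerPrefix-2^ K m odd-m)
    regroup : ∀ n P → 2 * (n + 1) * (3 * P) ≡ (3 * n + 3) * (2 * P)
    regroup = solve-∀

-- Non-anti-powers with m close to 3k/2

-- q + m = 2^N(3P+2) + (q − 1) with t(3P+2) = 1, so t(q + m) = ¬ t(q − 1); and as 6P ≡ 2 (mod 8),
-- t alternates on 6P, …, 6P+3.
tm-periodic-past-6P : ∀ {g N P u m} → P + 1 ≡ 2 ^ g → tm P ≡ false → P ≡ 4 * u + 3 → 6 * P + 3 ≤ 2 ^ N →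
                      m + 1 ≡ 2 ^ N * (3 * P + 2) → ∀ t → t < 3 → tm (6 * P + 1 + t + m) ≡ tm (6 * P + 1 + t)
tm-periodic-past-6P {g} {N} {P} {u} {m} P+1≡2^g tm-P P≡4u+3 6P+3≤2^N m+1≡ t t<3 = begin
  tm (6 * P + 1 + t + m)                   ≡⟨ cong tm index ⟩
  tm (2 ^ N * (3 * P + 2) + (6 * P + t))   ≡⟨ tm-split N (3 * P + 2) (6 * P + t) (<-≤-trans (+-monoʳ-< (6 * P) t<3) 6P+3≤2^N) ⟩
  tm (3 * P + 2) xor tm (6 * P + t)        ≡⟨ cong (_xor tm (6 * P + t)) tm[3P+2] ⟩
  not (tm (6 * P + t))                     ≡⟨ subst₂ (λ a b → tm a ≡ not (tm b)) (sym odd-index) (sym even-index) (tm-alternates (3 * u + 2) t t<3) ⟨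
  tm (6 * P + 1 + t)                       ∎
  where
  open ≡-Reasoning
  index : 6 * P + 1 + t + m ≡ 2 ^ N * (3 * P + 2) + (6 * P + t)
  index = begin
    6 * P + 1 + t + m              ≡⟨ solve (P ∷ t ∷ m ∷ []) ⟩
    m + 1 + (6 * P + t)            ≡⟨ cong (_+ (6 * P + t)) m+1≡ ⟩
    2 ^ N * (3 * P + 2) + (6 * P + t) ∎
  3P+2≡ : 3 * P + 2 ≡ 2 ^ g * 2 + P
  3P+2≡ = begin
    3 * P + 2               ≡⟨ solve (P ∷ []) ⟩
    (P + 1) * 2 + P         ≡⟨ cong (λ G → G * 2 + P) P+1≡2^g ⟩
    2 ^ g * 2 + P           ∎
  tm[3P+2] : tm (3 * P + 2) ≡ true
  tm[3P+2] = begin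
    tm (3 * P + 2)          ≡⟨ cong tm 3P+2≡ ⟩
    tm (2 ^ g * 2 + P)      ≡⟨ tm-split g 2 P (subst (P <_) P+1≡2^g (m<m+n P z<s)) ⟩
    tm 2 xor tm P           ≡⟨ cong (true xor_) tm-P ⟩
    true                    ∎
  odd-index : 6 * P + 1 + t ≡ 8 * (3 * u + 2) + (3 + t)
  odd-index = begin
    6 * P + 1 + t                  ≡⟨ cong (λ p → 6 * p + 1 + t) P≡4u+3 ⟩
    6 * (4 * u + 3) + 1 + t        ≡⟨ solve (u ∷ t ∷ []) ⟩
    8 * (3 * u + 2) + (3 + t)      ∎
  even-index : 6 * P + t ≡ 8 * (3 * u + 2) + (2 + t)
  even-index = begin
    6 * P + t                      ≡⟨ cong (λ p → 6 * p + t) P≡4u+3 ⟩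
    6 * (4 * u + 3) + t            ≡⟨ solve (u ∷ t ∷ []) ⟩
    8 * (3 * u + 2) + (2 + t)      ∎

block-2P+1-quotient-range : ∀ {A P m x q ρ} → m + 1 ≡ A * (3 * P + 2) → 2 * P + 1 ≤ A → x < m → ρ < A * (P + 1) →
                 (2 * P + 1) * m + x ≡ A * (P + 1) * q + ρ → ∃[ t ] (t < 3 × q ≡ 6 * P + 1 + t)
block-2P+1-quotient-range {A} {P} {m} {x} {q} {ρ} m+1≡ 2P+1≤A x<m ρ<S p≡ = q ∸ (6 * P + 1) , t<3 , sym (m+[n∸m]≡n 6P+1≤q)
  where
  open ≤-Reasoning
  S = A * (P + 1)
  lower-block : S * (6 * P + 1) ≤ (2 * P + 1) * m
  lower-block = +-cancelʳ-≤ (2 * P + 1) _ _ (begin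
    A * (P + 1) * (6 * P + 1) + (2 * P + 1)  ≤⟨ +-monoʳ-≤ (A * (P + 1) * (6 * P + 1)) 2P+1≤A ⟩
    A * (P + 1) * (6 * P + 1) + A            ≡⟨ solve (A ∷ P ∷ []) ⟩
    (2 * P + 1) * (A * (3 * P + 2))          ≡⟨ cong ((2 * P + 1) *_) m+1≡ ⟨
    (2 * P + 1) * (m + 1)                    ≡⟨ solve (P ∷ m ∷ []) ⟩
    (2 * P + 1) * m + (2 * P + 1)            ∎)
  6P+1≤q : 6 * P + 1 ≤ q
  6P+1≤q = ≤-pred (subst (6 * P + 1 <_) (+-comm q 1) (*-cancelˡ-< S (6 * P + 1) (q + 1) (begin-strict
    S * (6 * P + 1)           ≤⟨ lower-block ⟩
    (2 * P + 1) * m           ≤⟨ m≤m+n ((2 * P + 1) * m) x ⟩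
    (2 * P + 1) * m + x       ≡⟨ p≡ ⟩
    S * q + ρ                 <⟨ +-monoʳ-< (S * q) ρ<S ⟩
    S * q + S                 ≡⟨ cong (S * q +_) (*-identityʳ S) ⟨
    S * q + S * 1             ≡⟨ *-distribˡ-+ S q 1 ⟨
    S * (q + 1)               ∎)))
  q<6P+4 : q < 6 * P + 4
  q<6P+4 = *-cancelˡ-< S q (6 * P + 4) (begin-strict
    S * q                               ≤⟨ m≤m+n (S * q) ρ ⟩
    S * q + ρ                           ≡⟨ p≡ ⟨
    (2 * P + 1) * m + x                 <⟨ +-monoʳ-< ((2 * P + 1) * m) (<-≤-trans x<m (m≤m+n m (2 * P + 2))) ⟩
    (2 * P + 1) * m + (m + (2 * P + 2)) ≡⟨ solve (P ∷ m ∷ []) ⟩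
    (2 * P + 2) * (m + 1)               ≡⟨ cong ((2 * P + 2) *_) m+1≡ ⟩
    (2 * P + 2) * (A * (3 * P + 2))     ≡⟨ solve (A ∷ P ∷ []) ⟩
    A * (P + 1) * (6 * P + 4)           ∎)
  upper-end : 6 * P + 4 ≡ 6 * P + 1 + 3
  upper-end = solve (P ∷ [])
  t<3 : q ∸ (6 * P + 1) < 3
  t<3 = +-cancelˡ-< (6 * P + 1) (q ∸ (6 * P + 1)) 3
    (subst₂ _<_ (sym (m+[n∸m]≡n 6P+1≤q)) upper-end q<6P+4)

block-collision : ∀ {g N P u m} → P + 1 ≡ 2 ^ g → tm P ≡ false → P ≡ 4 * u + 3 → 6 * P + 3 ≤ 2 ^ N →
            m + 1 ≡ 2 ^ N * (3 * P + 2) → block m (2 * P + 1) ≡ block m (2 * P + 1 + 2 ^ (N + g))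
block-collision {g} {N} {P} {u} {m} P+1≡2^g tm-P P≡4u+3 6P+3≤2^N m+1≡ = block-shift (N + g) m (2 * P + 1) high-periodic
  where
  2^[N+g]≡ : 2 ^ (N + g) ≡ 2 ^ N * (P + 1)
  2^[N+g]≡ = trans (^-distribˡ-+-* 2 N g) (cong (2 ^ N *_) (sym P+1≡2^g))
  2P+1≤2^N : 2 * P + 1 ≤ 2 ^ N
  2P+1≤2^N = ≤-trans (m≤m+n (2 * P + 1) (4 * P + 2)) (subst (_≤ 2 ^ N) 6P+3≡ 6P+3≤2^N)
    where
    6P+3≡ : 6 * P + 3 ≡ 2 * P + 1 + (4 * P + 2)
    6P+3≡ = solve (P ∷ [])
  high-periodic : ∀ x q ρ → x < m → ρ < 2 ^ (N + g) → (2 * P + 1) * m + x ≡ 2 ^ (N + g) * q + ρ → tm (q + m) ≡ tm q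
  high-periodic x q ρ x<m ρ<S p≡ = from-range (block-2P+1-quotient-range m+1≡ 2P+1≤2^N x<m
    (subst (ρ <_) 2^[N+g]≡ ρ<S) (trans p≡ (cong (λ S → S * q + ρ) 2^[N+g]≡)))
    where
    from-range : ∃[ t ] (t < 3 × q ≡ 6 * P + 1 + t) → tm (q + m) ≡ tm q
    from-range (t , t<3 , q≡) = subst (λ q → tm (q + m) ≡ tm q) (sym q≡)
      (tm-periodic-past-6P {g} {N} {P} {u} P+1≡2^g tm-P P≡4u+3 6P+3≤2^N m+1≡ t t<3)

ratio-bound : ∀ n G A m k → 4 * (n + 1) ≤ G → G ≤ A → m + 1 + A ≡ 3 * (A * G) →
              k < 2 * G + 2 * (A * G) → (3 * n + 1) * k < 2 * (n + 1) * m
ratio-bound n G A m k 4[n+1]≤G G≤A m+1+A≡ k< = begin-strict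
  (3 * n + 1) * k                      <⟨ *-monoʳ-< (3 * n + 1) {{3n+1≢0}} k< ⟩
  (3 * n + 1) * (2 * G + 2 * (A * G))  ≤⟨ +-cancelʳ-≤ (2 * (n + 1) * (A + 1)) _ _ (begin
    (3 * n + 1) * (2 * G + 2 * (A * G)) + 2 * (n + 1) * (A + 1)
      ≡⟨ solve (n ∷ G ∷ A ∷ []) ⟩
    ((3 * n + 1) * (2 * G) + 2 * (n + 1) * (A + 1)) + (6 * n + 2) * (A * G)
      ≤⟨ +-monoˡ-≤ ((6 * n + 2) * (A * G)) slack ⟩
    4 * (A * G) + (6 * n + 2) * (A * G)
      ≡⟨ solve (n ∷ G ∷ A ∷ []) ⟩
    2 * (n + 1) * (3 * (A * G))
      ≡⟨ cong (2 * (n + 1) *_) m+1+A≡ ⟨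
    2 * (n + 1) * (m + 1 + A)
      ≡⟨ solve (n ∷ m ∷ A ∷ []) ⟩
    2 * (n + 1) * m + 2 * (n + 1) * (A + 1) ∎) ⟩
  2 * (n + 1) * m                      ∎
  where
  open ≤-Reasoning
  3n+1≢0 : NonZero (3 * n + 1)
  3n+1≢0 = >-nonZero (subst (0 <_) (+-comm 1 (3 * n)) z<s)
  1≤A : 1 ≤ A
  1≤A = ≤-trans (≤-trans (s≤s z≤n) (*-monoʳ-≤ 4 (m≤n+m 1 n))) (≤-trans 4[n+1]≤G G≤A)
  3n+1≤4[n+1] : 3 * n + 1 ≤ 4 * (n + 1)
  3n+1≤4[n+1] = ≤-trans (m≤m+n (3 * n + 1) (n + 3)) (≤-reflexive (solve (n ∷ [])))
  slack : (3 * n + 1) * (2 * G) + 2 * (n + 1) * (A + 1) ≤ 4 * (A * G)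
  slack = begin
    (3 * n + 1) * (2 * G) + 2 * (n + 1) * (A + 1)
      ≤⟨ +-mono-≤ (*-monoˡ-≤ (2 * G) 3n+1≤4[n+1]) (*-monoʳ-≤ (2 * (n + 1)) (+-monoʳ-≤ A 1≤A)) ⟩
    4 * (n + 1) * (2 * G) + 2 * (n + 1) * (A + A)
      ≡⟨ solve (n ∷ G ∷ A ∷ []) ⟩
    2 * G * (4 * (n + 1)) + A * (4 * (n + 1))
      ≤⟨ +-mono-≤ (*-monoʳ-≤ (2 * G) 4[n+1]≤G) (*-monoʳ-≤ A 4[n+1]≤G) ⟩
    2 * G * G + A * G
      ≤⟨ +-monoˡ-≤ (A * G) (*-monoʳ-≤ (2 * G) G≤A) ⟩
    2 * G * A + A * G
      ≡⟨ solve (G ∷ A ∷ []) ⟩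
    3 * (A * G)
      ≤⟨ *-monoˡ-≤ (A * G) (n≤1+n 3) ⟩
    4 * (A * G) ∎

lower-bound-at-scale : ∀ n g P u N k → P + 1 ≡ 2 ^ g → tm P ≡ false → P ≡ 4 * u + 3 → 4 * (n + 1) ≤ 2 ^ g →
                       3 + g ≤ N → 2 * 2 ^ g + 2 ^ (N + g) ≤ k → k < 2 * 2 ^ g + 2 * 2 ^ (N + g) →
                       ∃[ m ] (Odd m × ¬ AntiPowerPrefix k m × (3 * n + 1) * k < 2 * (n + 1) * m)
lower-bound-at-scale n g P u N k P+1≡2^g tm-P P≡4u+3 4[n+1]≤2^g 3+g≤N lo hi
  with odd-predecessor N (3 * P + 2) (≤-trans (s≤s z≤n) 3+g≤N) (<-≤-trans z<s (m≤n+m 2 (3 * P)))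
... | m , odd-m , m+1≡ = m , odd-m , not-anti , ratio
  where
  open ≡-Reasoning
  6P+3≤2^N : 6 * P + 3 ≤ 2 ^ N
  6P+3≤2^N = ≤-trans (≤-trans (m≤m+n (6 * P + 3) (2 * P + 5)) (≤-reflexive 8[P+1])) (^-monoʳ-≤ 2 3+g≤N)
    where
    8[P+1] : 6 * P + 3 + (2 * P + 5) ≡ 2 ^ (3 + g)
    8[P+1] = begin
      6 * P + 3 + (2 * P + 5)    ≡⟨ solve (P ∷ []) ⟩
      2 * (2 * (2 * (P + 1)))    ≡⟨ cong (λ G → 2 * (2 * (2 * G))) P+1≡2^g ⟩
      2 ^ (3 + g)                ∎
  i<j : 2 * P + 1 < 2 * P + 1 + 2 ^ (N + g)
  i<j = m<m+n (2 * P + 1) (m^n>0 2 (N + g))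
  j<k : 2 * P + 1 + 2 ^ (N + g) < k
  j<k = <-≤-trans (+-monoˡ-< (2 ^ (N + g)) 2P+1<2^g+1) lo
    where
    2[P+1] : suc (2 * P + 1) ≡ 2 * 2 ^ g
    2[P+1] = begin
      suc (2 * P + 1)    ≡⟨ solve (P ∷ []) ⟩
      2 * (P + 1)        ≡⟨ cong (2 *_) P+1≡2^g ⟩
      2 * 2 ^ g          ∎
    2P+1<2^g+1 : 2 * P + 1 < 2 * 2 ^ g
    2P+1<2^g+1 = subst (2 * P + 1 <_) 2[P+1] (n<1+n (2 * P + 1))
  not-anti : ¬ AntiPowerPrefix k m
  not-anti = equal-blocks⇒¬AntiPowerPrefix i<j j<k (block-collision {g} {N} {P} {u} P+1≡2^g tm-P P≡4u+3 6P+3≤2^N m+1≡)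
  ratio : (3 * n + 1) * k < 2 * (n + 1) * m
  ratio = ratio-bound n (2 ^ g) (2 ^ N) m k 4[n+1]≤2^g (^-monoʳ-≤ 2 (≤-trans (m≤n+m g 3) 3+g≤N)) m+1+A≡
    (subst (λ S → k < 2 * 2 ^ g + 2 * S) (^-distribˡ-+-* 2 N g) hi)
    where
    regroup : ∀ A → A * (3 * P + 2) + A ≡ 3 * (A * (P + 1))
    regroup A = solve (A ∷ P ∷ [])
    m+1+A≡ : m + 1 + 2 ^ N ≡ 3 * (2 ^ N * 2 ^ g)
    m+1+A≡ = begin
      m + 1 + 2 ^ N                  ≡⟨ cong (_+ 2 ^ N) m+1≡ ⟩
      2 ^ N * (3 * P + 2) + 2 ^ N    ≡⟨ regroup (2 ^ N) ⟩
      3 * (2 ^ N * (P + 1))          ≡⟨ cong (λ G → 3 * (2 ^ N * G)) P+1≡2^g ⟩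
      3 * (2 ^ N * 2 ^ g)            ∎

-- P = 2^g − 1 with g even, so that t(P) = 0 and P ≡ 3 (mod 4).
lower-bound : ∀ n → ∃[ K ] ∀ k → K ≤ k →
              ∃[ m ] (Odd m × ¬ AntiPowerPrefix k m × (3 * n + 1) * k < 2 * (n + 1) * m)
lower-bound n = 2 ^ (3 + g + g) + 2 * 2 ^ g , at-scale
  where
  g = 2 * suc n
  u = mersenne (2 * n)
  P≡4u+3 : mersenne g ≡ 4 * u + 3
  P≡4u+3 = trans (cong mersenne (*-suc 2 n)) (regroup u)
    where
    regroup : ∀ u → 2 * (2 * u + 1) + 1 ≡ 4 * u + 3
    regroup = solve-∀
  4[n+1]≤2^g : 4 * (n + 1) ≤ 2 ^ g
  4[n+1]≤2^g = subst₂ _≤_ (cong (4 *_) (+-comm 1 n)) (trans (*-assoc 2 2 (2 ^ (2 * n))) (cong (2 ^_) (sym (*-suc 2 n))))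
    (*-monoʳ-≤ 4 (≤-trans (n<2^n n) (^-monoʳ-≤ 2 (m≤m+n n (n + 0)))))
  at-scale : ∀ k → 2 ^ (3 + g + g) + 2 * 2 ^ g ≤ k →
             ∃[ m ] (Odd m × ¬ AntiPowerPrefix k m × (3 * n + 1) * k < 2 * (n + 1) * m)
  at-scale k K≤k = from-scale (dyadic-scale (3 + g) g (k ∸ 2 * 2 ^ g) x-bound)
    where
    x-bound : 2 ^ (3 + g + g) ≤ k ∸ 2 * 2 ^ g
    x-bound = subst (_≤ k ∸ 2 * 2 ^ g) (m+n∸n≡m (2 ^ (3 + g + g)) (2 * 2 ^ g)) (∸-monoˡ-≤ (2 * 2 ^ g) K≤k)
    k≡ : 2 * 2 ^ g + (k ∸ 2 * 2 ^ g) ≡ k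
    k≡ = m+[n∸m]≡n (≤-trans (m≤n+m (2 * 2 ^ g) (2 ^ (3 + g + g))) K≤k)
    from-scale : ∃[ N ] (3 + g ≤ N × 2 ^ (N + g) ≤ k ∸ 2 * 2 ^ g × k ∸ 2 * 2 ^ g < 2 * 2 ^ (N + g)) →
                 ∃[ m ] (Odd m × ¬ AntiPowerPrefix k m × (3 * n + 1) * k < 2 * (n + 1) * m)
    from-scale (N , 3+g≤N , lo , hi) =
      lower-bound-at-scale n g (mersenne g) u N k (mersenne+1 g) (tm-mersenne-even (suc n)) P≡4u+3 4[n+1]≤2^g 3+g≤N
        (subst (2 * 2 ^ g + 2 ^ (N + g) ≤_) k≡ (+-monoʳ-≤ (2 * 2 ^ g) lo))
        (subst (_< 2 * 2 ^ g + 2 * 2 ^ (N + g)) k≡ (+-monoʳ-< (2 * 2 ^ g) hi))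

theorem2 : (∀ n → ∃[ K ] ∀ k → K ≤ k →
    ∃[ m ] (Odd m × ¬ AntiPowerPrefix k m × (3 * n + 1) * k < 2 * (n + 1) * m))
    × (∀ n K → ∃[ k ] (K ≤ k × (∀ m → Odd m → ¬ AntiPowerPrefix k m →
    2 * (n + 1) * m < (3 * n + 5) * k)))
theorem2 = lower-bound , upper-bound
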